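{- Assume one of the following four settings: (i) $\mathfrak{D}'=\mathfrak{D}$ and $R\in\mathfrak{D}$; (ii) $\mathfrak{T}_a\subseteq\mathfrak{D}'\subseteq\mathfrak{D}$ and $R\in\mathfrak{T}_a$; (iii) $\mathfrak{D}'=\mathfrak{P}^*$ and $R\in\mathfrak{P}^*$; (iv) $\mathfrak{D}'=\mathfrak{P}$ and $R\in\mathfrak{P}$. Let $\mathfrak{a}\in\mathcal{E}_o(R)$. Then every automorphism $\pi$ of $X(\mathfrak{a})$ fixes $p$ and maps $D$ bijectively onto $D$ and $U$ bijectively onto $U$. Consequently: - $\alpha^R_{X(\mathfrak{a}),\iota(\mathfrak{a})}(p)=\mathfrak{a}$; - $\alpha^R_{X(\mathfrak{a}),\iota(\mathfrak{a})\circ\pi}(v)=\alpha^R_{X(\mathfrak{a}),\iota(\mathfrak{a})}(\pi(v))$ for all $v\in V(X(\mathfrak{a}))$ and all $\pi\in\mathrm{Aut}(X(\mathfrak{a}))$; - $\#\mathrm{Aut}(X(\mathfrak{a}))=(\#\mathfrak{a}_2)!\cdot(\#\mathfrak{a}_3)!=\#\{\iota(\mathfrak{a})\circ\pi:\pi\in\mathrm{Aut}(X(\mathfrak{a}))\}$.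
   Context: Digraphs $G=(V(G),A(G))$ have a finite nonempty vertex set, and $A(G)\subseteq V(G)\times V(G)$; loops are allowed. $G^*$ is $G$ with loops removed. $N^{in}_G(v)=\{w\ne v:wv\in A(G)\}$ and $N^{out}_G(v)=\{w\ne v:vw\in A(G)\}$. A homomorphism maps arcs to arcs; it is strict if, in addition, it maps proper arcs to proper arcs. $\mathcal{S}(G,H)$ is the set of strict homomorphisms. Classes of digraphs: - $\mathfrak{D}$ is a representative system of the isomorphism classes of finite digraphs; constructed digraphs are identified with their representatives. - $\mathfrak{T}_a=\{G\in\mathfrak{D}:G^*\text{ has no closed walk}\}$. - $\mathfrak{P}$ is the set of posets (reflexive, antisymmetric, transitive) in $\mathfrak{D}$, and $\mathfrak{P}^*=\{P^*:P\in\mathfrak{P}\}$. EV-system data: - $\mathcal{E}_o(R)=\{(v,D,U):v\in V(R),\ D\subseteq N^{in}_R(v),\ U\subseteq N^{out}_R(v)\}$, with components $\mathfrak{a}_1,\mathfrak{a}_2,\mathfrak{a}_3$. - $\alpha^R_{G,\xi}(v)=(\xi(v),\xi[N^{in}_G(v)],\xi[N^{out}_G(v)])$ for $G\in\mathfrak{D}'$ and $\xi\in\mathcal{S}(G,R)$. The digraph $X^m_n$ (for $m,n\ge0$) has vertex set $D\cup\{p\}\cup U$, where $D,U$ are disjoint with $\#D=m$, $\#U=n$ and $p\notin D\cup U$. Its arc set is $(D\times\{p\})\cup(\{p\}\times U)$. For $\mathfrak{a}\in\mathcal{E}_o(R)$, the digraph $X(\mathfrak{a})$ is: - $X^{\#\mathfrak{a}_2}_{\#\mathfrak{a}_3}$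 in settings (i) and (ii); - its transitive hull in setting (iii); - its transitive hull with a loop added at every vertex in setting (iv). $\iota(\mathfrak{a}):V(X(\mathfrak{a}))\to V(R)$ is a fixed map sending $p$ to $\mathfrak{a}_1$, $D$ bijectively onto $\mathfrak{a}_2$, and $U$ bijectively onto $\mathfrak{a}_3$. In each setting, $X(\mathfrak{a})\in\mathfrak{D}'$ and $\iota(\mathfrak{a})$ is a strict homomorphism. -}

module Defs where

open import Data.Nat using (ℕ; zero; suc; _+_)
open import Data.Bool using (Bool; true; false; _∧_; _∨_; not)
open import Data.Fin using (Fin; zero; suc; splitAt; _↑ˡ_; _↑ʳ_; _≟_)
open import Data.Fin.Properties using (any?)
open import Data.Fin.Subset using (Subset; _∈_; _⊆_; ∣_∣)
open import Data.Fin.Subset.Properties using (_∈?_)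
open import Data.Vec using (tabulate)
open import Data.Product using (Σ; ∃; _×_; _,_; proj₁)
open import Data.Sum using (inj₁; inj₂)
open import Data.Empty using (⊥)
open import Relation.Nullary using (¬_)
open import Relation.Nullary.Decidable using (⌊_⌋; _×-dec_)
open import Relation.Binary.PropositionalEquality using (_≡_; refl; sym; trans)
open import Relation.Binary.Bundles using (Setoid)
open import Function.Bundles using (_⇔_; Bijection)
import Relation.Binary.PropositionalEquality as ≡

record Digraph : Set where
  constructor mkDigraph
  field
    size : ℕ
    arc  : Fin size → Fin size → Bool
open Digraph public

_==_ : ∀ {k} → Fin k → Fin k → Bool
u == v = ⌊ u ≟ v ⌋

star : Digraph → Digraph
star G = mkDigraph (size G) (λ u v → arc G u v ∧ not (u == v))

Nin : (G : Digraph) → Fin (size G) → Subset (size G)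
Nin G v = tabulate (λ w → not (w == v) ∧ arc G w v)

Nout : (G : Digraph) → Fin (size G) → Subset (size G)
Nout G v = tabulate (λ w → not (w == v) ∧ arc G v w)

data Walk (G : Digraph) : Fin (size G) → Fin (size G) → Set where
  step : ∀ {u v} → arc G u v ≡ true → Walk G u v
  cons : ∀ {u w v} → arc G u w ≡ true → Walk G w v → Walk G u v

InTa : Digraph → Set
InTa G = ∀ v → ¬ Walk (star G) v v

IsPoset : Digraph → Set
IsPoset G =
  (∀ v → arc G v v ≡ true) ×
  (∀ u v → arc G u v ≡ true → arc G v u ≡ true → u ≡ v) ×
  (∀ u v w → arc G u v ≡ true → arc G v w ≡ true → arc G u w ≡ true)

IsPosetStar : Digraph → Set
IsPosetStar G = Σ (Fin (size G) → Fin (size G) → Bool) λ P →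
  IsPoset (mkDigraph (size G) P) ×
  (∀ u v → arc G u v ≡ arc (star (mkDigraph (size G) P)) u v)

data Setting : Set where
  s1 s2 s3 s4 : Setting

SettingHyp : Setting → (Digraph → Set) → Digraph → Set
SettingHyp s1 D' R = ∀ G → D' G
SettingHyp s2 D' R = (∀ G → InTa G → D' G) × InTa R
SettingHyp s3 D' R = (∀ G → D' G ⇔ IsPosetStar G) × IsPosetStar R
SettingHyp s4 D' R = (∀ G → D' G ⇔ IsPoset G) × IsPoset R

-- The digraph X^m_n, vertex set Fin (m + suc n):
--   D = { i ↑ˡ suc n : i : Fin m },  p = m ↑ʳ zero,  U = { m ↑ʳ suc j : j : Fin n }

dv : (m n : ℕ) → Fin m → Fin (m + suc n)
dv m n i = i ↑ˡ suc n

pv : (m n : ℕ) → Fin (m + suc n)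
pv m n = m ↑ʳ zero

uv : (m n : ℕ) → Fin n → Fin (m + suc n)
uv m n j = m ↑ʳ suc j

data Role : Set where
  inD isP inU : Role

role : (m n : ℕ) → Fin (m + suc n) → Role
role m n v with splitAt m v
... | inj₁ _       = inD
... | inj₂ zero    = isP
... | inj₂ (suc _) = inU

arcX : Role → Role → Bool
arcX inD isP = true
arcX isP inU = true
arcX _   _   = false

-- arcs of the transitive hull of X^m_n : additionally D × U
-- (all walks of X^m_n have length ≤ 2, the only ones of length 2 being d → p → u)
arcHull : Role → Role → Bool
arcHull inD isP = true
arcHull isP inU = true
arcHull inD inU = true
arcHull _   _   = false

-- X(𝔞) with #𝔞₂ = m, #𝔞₃ = n, in each setting
Xarc : Setting → (m n : ℕ) → Fin (m + suc n) → Fin (m + suc n) → Bool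
Xarc s1 m n u v = arcX (role m n u) (role m n v)
Xarc s2 m n u v = arcX (role m n u) (role m n v)
Xarc s3 m n u v = arcHull (role m n u) (role m n v)
Xarc s4 m n u v = arcHull (role m n u) (role m n v) ∨ (u == v)

Xdig : Setting → ℕ → ℕ → Digraph
Xdig s m n = mkDigraph (m + suc n) (Xarc s m n)

record Eo (R : Digraph) : Set where
  constructor mkEo
  field
    a₁ : Fin (size R)
    a₂ : Subset (size R)
    a₃ : Subset (size R)
    a₂⊆ : a₂ ⊆ Nin R a₁
    a₃⊆ : a₃ ⊆ Nout R a₁
open Eo public

EnumOf : ∀ {r k} → Subset r → (Fin k → Fin r) → Set
EnumOf S e = (∀ i j → e i ≡ e j → i ≡ j) × (∀ i → e i ∈ S) × (∀ w → w ∈ S → ∃ λ i → e i ≡ w)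

-- ι(𝔞) built from enumerations eD of 𝔞₂ and eU of 𝔞₃
iota : ∀ {r m n} → Fin r → (Fin m → Fin r) → (Fin n → Fin r) → Fin (m + suc n) → Fin r
iota {m = m} p eD eU v with splitAt m v
... | inj₁ i       = eD i
... | inj₂ zero    = p
... | inj₂ (suc j) = eU j

image : ∀ {k r} → (Fin k → Fin r) → Subset k → Subset r
image ξ S = tabulate (λ w → ⌊ any? (λ u → (u ∈? S) ×-dec (ξ u ≟ w)) ⌋)

α : ∀ {r} (G : Digraph) → (Fin (size G) → Fin r) → Fin (size G) → Fin r × Subset r × Subset r
α G ξ v = ξ v , image ξ (Nin G v) , image ξ (Nout G v)

record Aut (G : Digraph) : Set where
  field
    fun  : Fin (size G) → Fin (size G)
    inv  : Fin (size G) → Fin (size G)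
    invˡ : ∀ v → inv (fun v) ≡ v
    invʳ : ∀ v → fun (inv v) ≡ v
    pres : ∀ u v → arc G (fun u) (fun v) ≡ arc G u v
open Aut public

AutSetoid : Digraph → Setoid _ _
AutSetoid G = record
  { Carrier = Aut G
  ; _≈_ = λ π σ → ∀ v → fun π v ≡ fun σ v
  ; isEquivalence = record
    { refl = λ v → refl ; sym = λ e v → sym (e v) ; trans = λ e f v → trans (e v) (f v) } }

ComposedSetoid : ∀ {r} (G : Digraph) → (Fin (size G) → Fin r) → Setoid _ _
ComposedSetoid {r} G ξ = record
  { Carrier = Σ (Fin (size G) → Fin r) (λ f → ∃ λ (π : Aut G) → ∀ v → f v ≡ ξ (fun π v))
  ; _≈_ = λ f g → ∀ v → proj₁ f v ≡ proj₁ g v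
  ; isEquivalence = record
    { refl = λ v → refl ; sym = λ e v → sym (e v) ; trans = λ e f v → trans (e v) (f v) } }

HasCard : ∀ {c ℓ} → Setoid c ℓ → ℕ → Set _
HasCard S N = Bijection S (≡.setoid (Fin N))

MapsOnto : ∀ {k N} → (Fin N → Fin N) → (Fin k → Fin N) → Set
MapsOnto π f = (∀ i → ∃ λ j → π (f i) ≡ f j) × (∀ j → ∃ λ i → π (f i) ≡ f j)

module Submission where

-- Arcs into a vertex of D and out of a vertex of U can only be loops.  Hence an
-- automorphism π fixes p: were π p = d ∈ D, the arc d → p would be mapped to an
-- arc π d → d, forcing π d = d = π p.  It then maps the in-neighbours D of p
-- onto D and the out-neighbours U onto U, and conversely every pair of
-- permutations of D and U extends to an automorphism, so Aut X(𝔞) ≅ Sym(D) × Sym(U).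
-- Since ι(𝔞) is injective on D and on U, ι(𝔞) ∘ π determines π.

open import Defs
open import Data.Bool using (Bool; true; false; not; _∧_; _∨_)
open import Data.Nat using (ℕ; zero; suc; _+_; _*_; _!)
open import Data.Fin using (Fin; zero; suc; splitAt; punchIn; punchOut; _≟_)
open import Data.Fin.Properties
  using (any?; punchOut-cong; splitAt-↑ˡ; splitAt-↑ʳ; splitAt⁻¹-↑ˡ; splitAt⁻¹-↑ʳ; ↑ˡ-injective; ↑ʳ-injective; suc-injective; *↔×)
open import Data.Fin.Permutation as Perm
  using (Permutation′; _⟨$⟩ʳ_; _⟨$⟩ˡ_; permutation; remove; insert; insert-punchIn; insert-remove; remove-insert)
open import Data.Fin.Subset using (Subset; _∈_; _⊆_; ∣_∣)
open import Data.Fin.Subset.Properties using (_∈?_; ⊆-antisym)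
open import Data.Vec using (tabulate)
open import Data.Vec.Properties using (lookup∘tabulate; []=⇒lookup; lookup⇒[]=)
open import Data.Product using (∃; _×_; _,_; proj₁; proj₂)
open import Data.Product.Relation.Binary.Pointwise.NonDependent using (_×ₛ_; Pointwise-≡↔≡)
open import Data.Product.Function.NonDependent.Setoid using (_×-inverse_)
open import Data.Sum using (_⊎_; inj₁; inj₂)
open import Data.Empty using (⊥-elim)
open import Relation.Nullary using (¬_; Dec; yes; no)
open import Relation.Nullary.Decidable using (⌊_⌋; _×-dec_; isYes≗does; dec-true; dec-false)
open import Relation.Binary.Bundles using (Setoid)
open import Relation.Binary.PropositionalEquality as ≡
  using (_≡_; _≢_; _≗_; refl; sym; trans; cong; cong₂; subst; subst₂; module ≡-Reasoning)
open import Function using (_∘_; id)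
open import Function.Definitions using (Injective)
open import Function.Bundles using (Inverse)
open import Function.Properties.Inverse using (Inverse⇒Bijection)
open import Function.Construct.Symmetry using (↔-sym)
import Function.Construct.Composition as Compose
import Function.Construct.Identity as Identity

PermutationSetoid : ℕ → Setoid _ _
PermutationSetoid k = record
  { Carrier = Permutation′ k
  ; _≈_ = Perm._≈_
  ; isEquivalence = record
    { refl = λ i → refl ; sym = λ e i → sym (e i) ; trans = λ e f i → trans (e i) (f i) } }

punchOut-cong₂ : ∀ {k} {i i′ j j′ : Fin (suc k)} (i≢j : i ≢ j) (i′≢j′ : i′ ≢ j′) →
                 i ≡ i′ → j ≡ j′ → punchOut i≢j ≡ punchOut i′≢j′
punchOut-cong₂ {i = i} _ _ refl refl = punchOut-cong i refl

remove-cong : ∀ {k} (π ρ : Permutation′ (suc k)) → π Perm.≈ ρ → remove zero π Perm.≈ remove zero ρ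
remove-cong _ _ π≈ρ j = punchOut-cong₂ _ _ (π≈ρ zero) (π≈ρ (suc j))

insert-cong : ∀ {k} {i i′ : Fin (suc k)} {σ σ′ : Permutation′ k} →
              i ≡ i′ → σ Perm.≈ σ′ → insert zero i σ Perm.≈ insert zero i′ σ′
insert-cong i≡i′ σ≈σ′ zero = i≡i′
insert-cong {i = i} {i′} {σ} {σ′} i≡i′ σ≈σ′ (suc j) = begin
  insert zero i σ ⟨$⟩ʳ suc j    ≡⟨ insert-punchIn zero i σ j ⟩
  punchIn i (σ ⟨$⟩ʳ j)          ≡⟨ cong₂ punchIn i≡i′ (σ≈σ′ j) ⟩
  punchIn i′ (σ′ ⟨$⟩ʳ j)        ≡⟨ insert-punchIn zero i′ σ′ j ⟨
  insert zero i′ σ′ ⟨$⟩ʳ suc j  ∎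
  where open ≡-Reasoning

Permutation-suc↔Fin×Permutation : ∀ k →
  Inverse (PermutationSetoid (suc k)) (≡.setoid (Fin (suc k)) ×ₛ PermutationSetoid k)
Permutation-suc↔Fin×Permutation k = record
  { to = λ π → π ⟨$⟩ʳ zero , remove zero π
  ; from = λ x → insert zero (proj₁ x) (proj₂ x)
  ; to-cong = λ {π} {ρ} π≈ρ → π≈ρ zero , remove-cong π ρ π≈ρ
  ; from-cong = λ e → insert-cong (proj₁ e) (proj₂ e)
  ; inverse =
      (λ {x} {π} π≈ins → π≈ins zero , λ j → trans (remove-cong π (insert zero (proj₁ x) (proj₂ x)) π≈ins j) (remove-insert zero (proj₁ x) (proj₂ x) j))
    , (λ {π} e j → trans (insert-cong (proj₁ e) (proj₂ e) j) (insert-remove zero π j))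
  }

Fin×Fin↔Fin* : ∀ a b → Inverse (≡.setoid (Fin a) ×ₛ ≡.setoid (Fin b)) (≡.setoid (Fin (a * b)))
Fin×Fin↔Fin* a b = Compose.inverse Pointwise-≡↔≡ (↔-sym (*↔× {a} {b}))

Permutation↔Fin! : ∀ k → Inverse (PermutationSetoid k) (≡.setoid (Fin (k !)))
Permutation↔Fin! zero = record
  { to = λ _ → zero
  ; from = λ _ → Perm.id
  ; to-cong = λ _ → refl
  ; from-cong = λ _ ()
  ; inverse = (λ { {zero} _ → refl }) , (λ _ ())
  }
Permutation↔Fin! (suc k) =
  Compose.inverse (Permutation-suc↔Fin×Permutation k)
    (Compose.inverse (Identity.inverse _ ×-inverse Permutation↔Fin! k) (Fin×Fin↔Fin* (suc k) (k !)))

does⇒ : ∀ {A : Set} (a? : Dec A) → ⌊ a? ⌋ ≡ true → A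
does⇒ (yes a) _ = a
does⇒ (no _) ()

⌊⌋-true : ∀ {A : Set} (a? : Dec A) → A → ⌊ a? ⌋ ≡ true
⌊⌋-true a? a = trans (isYes≗does a?) (dec-true a? a)

⌊⌋-false : ∀ {A : Set} (a? : Dec A) → ¬ A → ⌊ a? ⌋ ≡ false
⌊⌋-false a? ¬a = trans (isYes≗does a?) (dec-false a? ¬a)

==⇒≡ : ∀ {k} (u v : Fin k) → (u == v) ≡ true → u ≡ v
==⇒≡ u v = does⇒ (u ≟ v)

==-injective : ∀ {k} (f : Fin k → Fin k) → Injective _≡_ _≡_ f → ∀ u v → (f u == f v) ≡ (u == v)
==-injective f f-inj u v with u ≟ v
... | yes u≡v = ⌊⌋-true (f u ≟ f v) (cong f u≡v)
... | no u≢v = ⌊⌋-false (f u ≟ f v) (u≢v ∘ f-inj)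

≢-∧⁻ : ∀ {k} (u v : Fin k) b → not (u == v) ∧ b ≡ true → u ≢ v × b ≡ true
≢-∧⁻ u v b e with u ≟ v
≢-∧⁻ u v b () | yes _
... | no u≢v = u≢v , e

≢-∧⁺ : ∀ {k} {u v : Fin k} {b} → u ≢ v → b ≡ true → not (u == v) ∧ b ≡ true
≢-∧⁺ {u = u} {v} u≢v e with u ≟ v
... | yes u≡v = ⊥-elim (u≢v u≡v)
... | no _ = e

∈-tabulate⁻ : ∀ {k} (f : Fin k → Bool) {w} → w ∈ tabulate f → f w ≡ true
∈-tabulate⁻ f {w} w∈ = trans (sym (lookup∘tabulate f w)) ([]=⇒lookup w∈)

∈-tabulate⁺ : ∀ {k} (f : Fin k → Bool) {w} → f w ≡ true → w ∈ tabulate f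
∈-tabulate⁺ f {w} e = lookup⇒[]= w (tabulate f) (trans (lookup∘tabulate f w) e)

∈-image⁻ : ∀ {k r} (ξ : Fin k → Fin r) {S w} → w ∈ image ξ S → ∃ λ u → u ∈ S × ξ u ≡ w
∈-image⁻ ξ {S} {w} w∈ = does⇒ (any? (λ u → (u ∈? S) ×-dec (ξ u ≟ w))) (∈-tabulate⁻ _ w∈)

∈-image⁺ : ∀ {k r} (ξ : Fin k → Fin r) {S u} → u ∈ S → ξ u ∈ image ξ S
∈-image⁺ ξ {u = u} u∈S = ∈-tabulate⁺ _ (⌊⌋-true (any? _) (u , u∈S , refl))

image-∘ : ∀ {k r} (π ρ : Fin k → Fin k) (ξ : Fin k → Fin r) {S T : Subset k} →
          (∀ t → π (ρ t) ≡ t) → (∀ {u} → u ∈ S → π u ∈ T) → (∀ {u} → π u ∈ T → u ∈ S) →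
          image (ξ ∘ π) S ≡ image ξ T
image-∘ π ρ ξ {S} {T} πρ≗id to-T from-T = ⊆-antisym ⊆T ⊇T
  where
  ⊆T : image (ξ ∘ π) S ⊆ image ξ T
  ⊆T w∈ with ∈-image⁻ (ξ ∘ π) w∈
  ... | u , u∈S , refl = ∈-image⁺ ξ (to-T u∈S)
  ⊇T : image ξ T ⊆ image (ξ ∘ π) S
  ⊇T w∈ with ∈-image⁻ ξ w∈
  ... | t , t∈T , refl = subst (_∈ image (ξ ∘ π) S) (cong ξ (πρ≗id t))
    (∈-image⁺ (ξ ∘ π) (from-T (subst (_∈ T) (sym (πρ≗id t)) t∈T)))

image-enumerated : ∀ {k N r} {S : Subset N} {T : Subset r} (e : Fin k → Fin N) (ξ : Fin N → Fin r) {f : Fin k → Fin r} →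
                   (∀ {u} → u ∈ S → ∃ λ i → u ≡ e i) → (∀ i → e i ∈ S) → (∀ i → ξ (e i) ≡ f i) → EnumOf T f →
                   image ξ S ≡ T
image-enumerated {S = S} {T} e ξ {f} S⊆e e∈S ξ∘e≗f (_ , f∈T , f-onto) = ⊆-antisym ⊆T ⊇T
  where
  ⊆T : image ξ S ⊆ T
  ⊆T w∈ with ∈-image⁻ ξ w∈
  ... | u , u∈S , refl with S⊆e u∈S
  ...   | i , refl = subst (_∈ T) (sym (ξ∘e≗f i)) (f∈T i)
  ⊇T : T ⊆ image ξ S
  ⊇T w∈T with f-onto _ w∈T
  ... | i , refl = subst (_∈ image ξ S) (ξ∘e≗f i) (∈-image⁺ ξ (e∈S i))

∈-Nin⁻ : ∀ G {u v} → u ∈ Nin G v → u ≢ v × arc G u v ≡ true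
∈-Nin⁻ G {u} {v} u∈ = ≢-∧⁻ u v _ (∈-tabulate⁻ _ u∈)

∈-Nin⁺ : ∀ G {u v} → u ≢ v → arc G u v ≡ true → u ∈ Nin G v
∈-Nin⁺ G u≢v uv = ∈-tabulate⁺ _ (≢-∧⁺ u≢v uv)

∈-Nout⁻ : ∀ G {u v} → u ∈ Nout G v → u ≢ v × arc G v u ≡ true
∈-Nout⁻ G {u} {v} u∈ = ≢-∧⁻ u v _ (∈-tabulate⁻ _ u∈)

∈-Nout⁺ : ∀ G {u v} → u ≢ v → arc G v u ≡ true → u ∈ Nout G v
∈-Nout⁺ G u≢v vu = ∈-tabulate⁺ _ (≢-∧⁺ u≢v vu)

module _ {G : Digraph} where

  Aut⁻¹ : Aut G → Aut G
  Aut⁻¹ π = record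
    { fun = inv π ; inv = fun π ; invˡ = invʳ π ; invʳ = invˡ π
    ; pres = λ u v → trans (sym (pres π (inv π u) (inv π v))) (cong₂ (arc G) (invʳ π u) (invʳ π v)) }

  fun-injective : (π : Aut G) → Injective _≡_ _≡_ (fun π)
  fun-injective π {u} {v} e = trans (sym (invˡ π u)) (trans (cong (inv π) e) (invˡ π v))

  module _ (π : Aut G) {u v : Fin (size G)} where

    ∈-Nin-fun⁺ : u ∈ Nin G v → fun π u ∈ Nin G (fun π v)
    ∈-Nin-fun⁺ u∈ with ∈-Nin⁻ G u∈
    ... | u≢v , uv = ∈-Nin⁺ G (u≢v ∘ fun-injective π) (trans (pres π u v) uv)

    ∈-Nin-fun⁻ : fun π u ∈ Nin G (fun π v) → u ∈ Nin G v
    ∈-Nin-fun⁻ πu∈ with ∈-Nin⁻ G πu∈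
    ... | πu≢πv , πuπv = ∈-Nin⁺ G (πu≢πv ∘ cong (fun π)) (trans (sym (pres π u v)) πuπv)

    ∈-Nout-fun⁺ : u ∈ Nout G v → fun π u ∈ Nout G (fun π v)
    ∈-Nout-fun⁺ u∈ with ∈-Nout⁻ G u∈
    ... | u≢v , vu = ∈-Nout⁺ G (u≢v ∘ fun-injective π) (trans (pres π v u) vu)

    ∈-Nout-fun⁻ : fun π u ∈ Nout G (fun π v) → u ∈ Nout G v
    ∈-Nout-fun⁻ πu∈ with ∈-Nout⁻ G πu∈
    ... | πu≢πv , πvπu = ∈-Nout⁺ G (πu≢πv ∘ cong (fun π)) (trans (sym (pres π v u)) πvπu)

  α-∘-fun : ∀ {r} (π : Aut G) (ξ : Fin (size G) → Fin r) v → α G (ξ ∘ fun π) v ≡ α G ξ (fun π v)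
  α-∘-fun π ξ v = cong (ξ (fun π v) ,_) (cong₂ _,_
    (image-∘ (fun π) (inv π) ξ (invʳ π) (∈-Nin-fun⁺ π) (∈-Nin-fun⁻ π))
    (image-∘ (fun π) (inv π) ξ (invʳ π) (∈-Nout-fun⁺ π) (∈-Nout-fun⁻ π)))

  Composed↔Aut : ∀ {r} (ξ : Fin (size G) → Fin r) →
                 (∀ π ρ → (∀ v → ξ (fun π v) ≡ ξ (fun ρ v)) → fun π ≗ fun ρ) →
                 Inverse (ComposedSetoid G ξ) (AutSetoid G)
  Composed↔Aut ξ ξ∘-injective = record
    { to = λ x → proj₁ (proj₂ x)
    ; from = λ π → ξ ∘ fun π , π , λ _ → refl
    ; to-cong = λ {x} {y} e → ξ∘-injective (proj₁ (proj₂ x)) (proj₁ (proj₂ y)) λ v → trans (sym (proj₂ (proj₂ x) v)) (trans (e v) (proj₂ (proj₂ y) v))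
    ; from-cong = λ e v → cong ξ (e v)
    ; inverse = (λ {π} {y} e → ξ∘-injective (proj₁ (proj₂ y)) π λ v → trans (sym (proj₂ (proj₂ y) v)) (e v))
              , (λ {x} e v → trans (cong ξ (e v)) (sym (proj₂ (proj₂ x) v)))
    }

module Restriction {G : Digraph} (π : Aut G) {k} (e : Fin k → Fin (size G)) (e-injective : Injective _≡_ _≡_ e)
                   (fun-e : ∀ i → ∃ λ j → fun π (e i) ≡ e j) (inv-e : ∀ i → ∃ λ j → inv π (e i) ≡ e j) where

  restriction : Permutation′ k
  restriction = permutation (proj₁ ∘ fun-e) (proj₁ ∘ inv-e) (cancel π fun-e inv-e) (cancel (Aut⁻¹ π) inv-e fun-e)
    where
    cancel : (σ : Aut G) (σ-e : ∀ i → ∃ λ j → fun σ (e i) ≡ e j) (σ⁻¹-e : ∀ i → ∃ λ j → inv σ (e i) ≡ e j) →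
             ∀ i → proj₁ (σ-e (proj₁ (σ⁻¹-e i))) ≡ i
    cancel σ σ-e σ⁻¹-e i = e-injective (begin
      e (proj₁ (σ-e j))   ≡⟨ proj₂ (σ-e j) ⟨
      fun σ (e j)         ≡⟨ cong (fun σ) (proj₂ (σ⁻¹-e i)) ⟨
      fun σ (inv σ (e i)) ≡⟨ invʳ σ (e i) ⟩
      e i                 ∎)
      where
      open ≡-Reasoning
      j = proj₁ (σ⁻¹-e i)

  restriction-correct : ∀ i → e (restriction ⟨$⟩ʳ i) ≡ fun π (e i)
  restriction-correct i = sym (proj₂ (fun-e i))

  restriction-mapsOnto : MapsOnto (fun π) e
  restriction-mapsOnto = fun-e , λ j → restriction ⟨$⟩ˡ j ,
    trans (sym (restriction-correct _)) (cong e (Perm.inverseʳ restriction))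

injective-on-range : ∀ {A B : Set} {k} (e : Fin k → A) (ξ : A → B) → Injective _≡_ _≡_ (ξ ∘ e) →
                     ∀ {x y i j} → x ≡ e i → y ≡ e j → ξ x ≡ ξ y → x ≡ y
injective-on-range e ξ ξ∘e-injective refl refl ξx≡ξy = cong e (ξ∘e-injective ξx≡ξy)

data VertexView (m n : ℕ) : Fin (m + suc n) → Set where
  at-dv : ∀ i → VertexView m n (dv m n i)
  at-pv : VertexView m n (pv m n)
  at-uv : ∀ j → VertexView m n (uv m n j)

vertexView : ∀ {m n} v → VertexView m n v
vertexView {m} {n} v with splitAt m v in eq
... | inj₁ i = subst (VertexView m n) (splitAt⁻¹-↑ˡ eq) (at-dv i)
... | inj₂ zero = subst (VertexView m n) (splitAt⁻¹-↑ʳ eq) at-pv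
... | inj₂ (suc j) = subst (VertexView m n) (splitAt⁻¹-↑ʳ eq) (at-uv j)

≗-by-vertices : ∀ {m n} {A : Set} (f g : Fin (m + suc n) → A) →
                (∀ i → f (dv m n i) ≡ g (dv m n i)) → f (pv m n) ≡ g (pv m n) → (∀ j → f (uv m n j) ≡ g (uv m n j)) →
                f ≗ g
≗-by-vertices f g on-D on-p on-U v with vertexView v
... | at-dv i = on-D i
... | at-pv = on-p
... | at-uv j = on-U j

module _ {m n : ℕ} where

  role-dv : ∀ i → role m n (dv m n i) ≡ inD
  role-dv i rewrite splitAt-↑ˡ m i (suc n) = refl

  role-pv : role m n (pv m n) ≡ isP
  role-pv rewrite splitAt-↑ʳ m (suc n) zero = refl

  role-uv : ∀ j → role m n (uv m n j) ≡ inU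
  role-uv j rewrite splitAt-↑ʳ m (suc n) (suc j) = refl

  dv-injective : Injective _≡_ _≡_ (dv m n)
  dv-injective = ↑ˡ-injective (suc n) _ _

  uv-injective : Injective _≡_ _≡_ (uv m n)
  uv-injective e = suc-injective (↑ʳ-injective m _ _ e)

  dv≢pv : ∀ i → dv m n i ≢ pv m n
  dv≢pv i e with trans (sym (role-dv i)) (trans (cong (role m n) e) role-pv)
  ... | ()

  uv≢pv : ∀ j → uv m n j ≢ pv m n
  uv≢pv j e with trans (sym (role-uv j)) (trans (cong (role m n) e) role-pv)
  ... | ()

  hull-into-dv : ∀ x i → arcHull (role m n x) (role m n (dv m n i)) ≢ true
  hull-into-dv x i rewrite role-dv i with role m n x
  ... | inD = λ ()
  ... | isP = λ ()
  ... | inU = λ ()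

  hull-from-uv : ∀ j x → arcHull (role m n (uv m n j)) (role m n x) ≢ true
  hull-from-uv j x rewrite role-uv j with role m n x
  ... | inD = λ ()
  ... | isP = λ ()
  ... | inU = λ ()

arcX⇒arcHull : ∀ r r′ → arcX r r′ ≡ true → arcHull r r′ ≡ true
arcX⇒arcHull inD isP _ = refl
arcX⇒arcHull isP inU _ = refl
arcX⇒arcHull inD inD ()
arcX⇒arcHull inD inU ()
arcX⇒arcHull isP inD ()
arcX⇒arcHull isP isP ()
arcX⇒arcHull inU _ ()

arcX⇒Xarc : ∀ s {m n} (x y : Fin (m + suc n)) → arcX (role m n x) (role m n y) ≡ true → Xarc s m n x y ≡ true
arcX⇒Xarc s1 x y e = e
arcX⇒Xarc s2 x y e = e
arcX⇒Xarc s3 x y e = arcX⇒arcHull _ _ e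
arcX⇒Xarc s4 x y e rewrite arcX⇒arcHull _ _ e = refl

Xarc⇒arcHull⊎loop : ∀ s {m n} {x y : Fin (m + suc n)} → Xarc s m n x y ≡ true →
                    arcHull (role m n x) (role m n y) ≡ true ⊎ x ≡ y
Xarc⇒arcHull⊎loop s1 e = inj₁ (arcX⇒arcHull _ _ e)
Xarc⇒arcHull⊎loop s2 e = inj₁ (arcX⇒arcHull _ _ e)
Xarc⇒arcHull⊎loop s3 e = inj₁ e
Xarc⇒arcHull⊎loop s4 {m} {n} {x} {y} e with arcHull (role m n x) (role m n y)
... | true = inj₁ refl
... | false = inj₂ (==⇒≡ x y e)

Xarc-resp-role : ∀ s {m n} (F : Fin (m + suc n) → Fin (m + suc n)) → role m n ∘ F ≗ role m n → Injective _≡_ _≡_ F →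
                 ∀ x y → Xarc s m n (F x) (F y) ≡ Xarc s m n x y
Xarc-resp-role s1 F F-role F-injective x y = cong₂ arcX (F-role x) (F-role y)
Xarc-resp-role s2 F F-role F-injective x y = cong₂ arcX (F-role x) (F-role y)
Xarc-resp-role s3 F F-role F-injective x y = cong₂ arcHull (F-role x) (F-role y)
Xarc-resp-role s4 F F-role F-injective x y = cong₂ _∨_ (cong₂ arcHull (F-role x) (F-role y)) (==-injective F F-injective x y)

module _ (s : Setting) {m n : ℕ} where

  Xarc-dv-pv : ∀ i → Xarc s m n (dv m n i) (pv m n) ≡ true
  Xarc-dv-pv i = arcX⇒Xarc s _ _ (subst₂ (λ r r′ → arcX r r′ ≡ true) (sym (role-dv i)) (sym role-pv) refl)

  Xarc-pv-uv : ∀ j → Xarc s m n (pv m n) (uv m n j) ≡ true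
  Xarc-pv-uv j = arcX⇒Xarc s _ _ (subst₂ (λ r r′ → arcX r r′ ≡ true) (sym role-pv) (sym (role-uv j)) refl)

  Xarc-into-dv : ∀ {x} i → Xarc s m n x (dv m n i) ≡ true → x ≡ dv m n i
  Xarc-into-dv {x} i a with Xarc⇒arcHull⊎loop s a
  ... | inj₁ h = ⊥-elim (hull-into-dv x i h)
  ... | inj₂ loop = loop

  Xarc-from-uv : ∀ {x} j → Xarc s m n (uv m n j) x ≡ true → x ≡ uv m n j
  Xarc-from-uv {x} j a with Xarc⇒arcHull⊎loop s a
  ... | inj₁ h = ⊥-elim (hull-from-uv j x h)
  ... | inj₂ loop = sym loop

  Xarc-into-pv : ∀ {x} → x ≢ pv m n → Xarc s m n x (pv m n) ≡ true → ∃ λ i → x ≡ dv m n i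
  Xarc-into-pv {x} x≢p a with vertexView x | Xarc⇒arcHull⊎loop s a
  ... | at-dv i | _ = i , refl
  ... | at-pv | _ = ⊥-elim (x≢p refl)
  ... | at-uv j | inj₁ h = ⊥-elim (hull-from-uv j (pv m n) h)
  ... | at-uv j | inj₂ loop = ⊥-elim (x≢p loop)

  Xarc-from-pv : ∀ {x} → x ≢ pv m n → Xarc s m n (pv m n) x ≡ true → ∃ λ j → x ≡ uv m n j
  Xarc-from-pv {x} x≢p a with vertexView x | Xarc⇒arcHull⊎loop s a
  ... | at-uv j | _ = j , refl
  ... | at-pv | _ = ⊥-elim (x≢p refl)
  ... | at-dv i | inj₁ h = ⊥-elim (hull-into-dv (pv m n) i h)
  ... | at-dv i | inj₂ loop = ⊥-elim (x≢p (sym loop))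

module _ {m n : ℕ} where

  Xmap : (Fin m → Fin m) → (Fin n → Fin n) → Fin (m + suc n) → Fin (m + suc n)
  Xmap g h v with splitAt m v
  ... | inj₁ i = dv m n (g i)
  ... | inj₂ zero = pv m n
  ... | inj₂ (suc j) = uv m n (h j)

  module _ (g : Fin m → Fin m) (h : Fin n → Fin n) where

    Xmap-dv : ∀ i → Xmap g h (dv m n i) ≡ dv m n (g i)
    Xmap-dv i rewrite splitAt-↑ˡ m i (suc n) = refl

    Xmap-pv : Xmap g h (pv m n) ≡ pv m n
    Xmap-pv rewrite splitAt-↑ʳ m (suc n) zero = refl

    Xmap-uv : ∀ j → Xmap g h (uv m n j) ≡ uv m n (h j)
    Xmap-uv j rewrite splitAt-↑ʳ m (suc n) (suc j) = refl

    role-Xmap : role m n ∘ Xmap g h ≗ role m n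
    role-Xmap = ≗-by-vertices _ _
      (λ i → trans (cong (role m n) (Xmap-dv i)) (trans (role-dv (g i)) (sym (role-dv i))))
      (cong (role m n) Xmap-pv)
      (λ j → trans (cong (role m n) (Xmap-uv j)) (trans (role-uv (h j)) (sym (role-uv j))))

  Xmap-inverse : ∀ {g g′ h h′} → (∀ i → g (g′ i) ≡ i) → (∀ j → h (h′ j) ≡ j) → Xmap g h ∘ Xmap g′ h′ ≗ id
  Xmap-inverse {g} {g′} {h} {h′} gg′ hh′ = ≗-by-vertices _ _
    (λ i → trans (cong (Xmap g h) (Xmap-dv g′ h′ i)) (trans (Xmap-dv g h (g′ i)) (cong (dv m n) (gg′ i))))
    (trans (cong (Xmap g h) (Xmap-pv g′ h′)) (Xmap-pv g h))
    (λ j → trans (cong (Xmap g h) (Xmap-uv g′ h′ j)) (trans (Xmap-uv g h (h′ j)) (cong (uv m n) (hh′ j))))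

module AutomorphismsOfX (s : Setting) (m n : ℕ) where

  X : Digraph
  X = Xdig s m n

  module _ (π : Aut X) where

    fun-pv : fun π (pv m n) ≡ pv m n
    fun-pv = fixed (vertexView (fun π (pv m n))) refl
      where
      arc-to-fun-pv : ∀ i → Xarc s m n (fun π (dv m n i)) (fun π (pv m n)) ≡ true
      arc-to-fun-pv i = trans (pres π _ _) (Xarc-dv-pv s i)
      arc-from-fun-pv : ∀ j → Xarc s m n (fun π (pv m n)) (fun π (uv m n j)) ≡ true
      arc-from-fun-pv j = trans (pres π _ _) (Xarc-pv-uv s j)
      fixed : ∀ {w} → VertexView m n w → fun π (pv m n) ≡ w → fun π (pv m n) ≡ pv m n
      fixed (at-dv i) πp≡dᵢ = ⊥-elim (dv≢pv i (fun-injective π (trans πdᵢ≡dᵢ (sym πp≡dᵢ))))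
        where
        πdᵢ≡dᵢ : fun π (dv m n i) ≡ dv m n i
        πdᵢ≡dᵢ = Xarc-into-dv s i (subst (λ z → Xarc s m n (fun π (dv m n i)) z ≡ true) πp≡dᵢ (arc-to-fun-pv i))
      fixed at-pv πp≡p = πp≡p
      fixed (at-uv j) πp≡uⱼ = ⊥-elim (uv≢pv j (fun-injective π (trans πuⱼ≡uⱼ (sym πp≡uⱼ))))
        where
        πuⱼ≡uⱼ : fun π (uv m n j) ≡ uv m n j
        πuⱼ≡uⱼ = Xarc-from-uv s j (subst (λ z → Xarc s m n z (fun π (uv m n j)) ≡ true) πp≡uⱼ (arc-from-fun-pv j))

    fun-≢-pv : ∀ {v} → v ≢ pv m n → fun π v ≢ pv m n
    fun-≢-pv v≢p πv≡p = v≢p (fun-injective π (trans πv≡p (sym fun-pv)))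

    fun-dv : ∀ i → ∃ λ j → fun π (dv m n i) ≡ dv m n j
    fun-dv i = Xarc-into-pv s (fun-≢-pv (dv≢pv i))
      (subst (λ z → Xarc s m n (fun π (dv m n i)) z ≡ true) fun-pv (trans (pres π _ _) (Xarc-dv-pv s i)))

    fun-uv : ∀ j → ∃ λ k → fun π (uv m n j) ≡ uv m n k
    fun-uv j = Xarc-from-pv s (fun-≢-pv (uv≢pv j))
      (subst (λ z → Xarc s m n z (fun π (uv m n j)) ≡ true) fun-pv (trans (pres π _ _) (Xarc-pv-uv s j)))

  module OnD (π : Aut X) = Restriction π (dv m n) dv-injective (fun-dv π) (fun-dv (Aut⁻¹ π))
  module OnU (π : Aut X) = Restriction π (uv m n) uv-injective (fun-uv π) (fun-uv (Aut⁻¹ π))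

  fromPermutations : Permutation′ m → Permutation′ n → Aut X
  fromPermutations σ τ = record
    { fun = F ; inv = F⁻¹ ; invˡ = F⁻¹∘F≗id ; invʳ = Xmap-inverse (λ _ → Perm.inverseʳ σ) (λ _ → Perm.inverseʳ τ)
    ; pres = Xarc-resp-role s F (role-Xmap _ _) λ {x} {y} Fx≡Fy → trans (sym (F⁻¹∘F≗id x)) (trans (cong F⁻¹ Fx≡Fy) (F⁻¹∘F≗id y)) }
    where
    F F⁻¹ : Fin (m + suc n) → Fin (m + suc n)
    F = Xmap (σ ⟨$⟩ʳ_) (τ ⟨$⟩ʳ_)
    F⁻¹ = Xmap (σ ⟨$⟩ˡ_) (τ ⟨$⟩ˡ_)
    F⁻¹∘F≗id : F⁻¹ ∘ F ≗ id
    F⁻¹∘F≗id = Xmap-inverse (λ _ → Perm.inverseˡ σ) (λ _ → Perm.inverseˡ τ)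

  Aut↔Permutation² : Inverse (AutSetoid X) (PermutationSetoid m ×ₛ PermutationSetoid n)
  Aut↔Permutation² = record
    { to = λ π → OnD.restriction π , OnU.restriction π
    ; from = λ x → fromPermutations (proj₁ x) (proj₂ x)
    ; to-cong = λ {π} {ρ} π≈ρ →
        (λ i → dv-injective (trans (OnD.restriction-correct π i) (trans (π≈ρ _) (sym (OnD.restriction-correct ρ i)))))
      , (λ j → uv-injective (trans (OnU.restriction-correct π j) (trans (π≈ρ _) (sym (OnU.restriction-correct ρ j)))))
    ; from-cong = λ {x} {y} e → ≗-by-vertices _ _
        (λ i → trans (Xmap-dv _ _ i) (trans (cong (dv m n) (proj₁ e i)) (sym (Xmap-dv _ _ i))))
        (trans (Xmap-pv _ _) (sym (Xmap-pv _ _)))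
        (λ j → trans (Xmap-uv _ _ j) (trans (cong (uv m n) (proj₂ e j)) (sym (Xmap-uv _ _ j))))
    ; inverse =
        (λ {x} {π} π≈ →
            (λ i → dv-injective (trans (OnD.restriction-correct π i) (trans (π≈ _) (Xmap-dv _ _ i))))
          , (λ j → uv-injective (trans (OnU.restriction-correct π j) (trans (π≈ _) (Xmap-uv _ _ j)))))
      , (λ {π} e → ≗-by-vertices _ _
            (λ i → trans (Xmap-dv _ _ i) (trans (cong (dv m n) (proj₁ e i)) (OnD.restriction-correct π i)))
            (trans (Xmap-pv _ _) (sym (fun-pv π)))
            (λ j → trans (Xmap-uv _ _ j) (trans (cong (uv m n) (proj₂ e j)) (OnU.restriction-correct π j))))
    }

  Aut↔Fin[m!*n!] : Inverse (AutSetoid X) (≡.setoid (Fin (m ! * n !)))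
  Aut↔Fin[m!*n!] = Compose.inverse Aut↔Permutation²
    (Compose.inverse (Permutation↔Fin! m ×-inverse Permutation↔Fin! n) (Fin×Fin↔Fin* (m !) (n !)))

  Nin-pv⊆dv : ∀ {u} → u ∈ Nin X (pv m n) → ∃ λ i → u ≡ dv m n i
  Nin-pv⊆dv u∈ = Xarc-into-pv s (proj₁ (∈-Nin⁻ X u∈)) (proj₂ (∈-Nin⁻ X u∈))

  dv∈Nin-pv : ∀ i → dv m n i ∈ Nin X (pv m n)
  dv∈Nin-pv i = ∈-Nin⁺ X (dv≢pv i) (Xarc-dv-pv s i)

  Nout-pv⊆uv : ∀ {u} → u ∈ Nout X (pv m n) → ∃ λ j → u ≡ uv m n j
  Nout-pv⊆uv u∈ = Xarc-from-pv s (proj₁ (∈-Nout⁻ X u∈)) (proj₂ (∈-Nout⁻ X u∈))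

  uv∈Nout-pv : ∀ j → uv m n j ∈ Nout X (pv m n)
  uv∈Nout-pv j = ∈-Nout⁺ X (uv≢pv j) (Xarc-pv-uv s j)

  module Labelling {r} (c : Fin r) {S₂ S₃ : Subset r} {eD : Fin m → Fin r} {eU : Fin n → Fin r}
                   (enD : EnumOf S₂ eD) (enU : EnumOf S₃ eU) where

    ι : Fin (m + suc n) → Fin r
    ι = iota c eD eU

    iota-dv : ∀ i → ι (dv m n i) ≡ eD i
    iota-dv i rewrite splitAt-↑ˡ m i (suc n) = refl

    iota-pv : ι (pv m n) ≡ c
    iota-pv rewrite splitAt-↑ʳ m (suc n) zero = refl

    iota-uv : ∀ j → ι (uv m n j) ≡ eU j
    iota-uv j rewrite splitAt-↑ʳ m (suc n) (suc j) = refl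

    α-iota-pv : α X ι (pv m n) ≡ (c , S₂ , S₃)
    α-iota-pv = cong₂ _,_ iota-pv (cong₂ _,_
      (image-enumerated (dv m n) ι Nin-pv⊆dv dv∈Nin-pv iota-dv enD)
      (image-enumerated (uv m n) ι Nout-pv⊆uv uv∈Nout-pv iota-uv enU))

    iota∘fun-injective : ∀ π ρ → (∀ v → ι (fun π v) ≡ ι (fun ρ v)) → fun π ≗ fun ρ
    iota∘fun-injective π ρ agree = ≗-by-vertices (fun π) (fun ρ)
      (λ i → injective-on-range (dv m n) ι ι∘dv-injective (proj₂ (fun-dv π i)) (proj₂ (fun-dv ρ i)) (agree _))
      (trans (fun-pv π) (sym (fun-pv ρ)))
      (λ j → injective-on-range (uv m n) ι ι∘uv-injective (proj₂ (fun-uv π j)) (proj₂ (fun-uv ρ j)) (agree _))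
      where
      ι∘dv-injective : Injective _≡_ _≡_ (ι ∘ dv m n)
      ι∘dv-injective e = proj₁ enD _ _ (trans (sym (iota-dv _)) (trans e (iota-dv _)))
      ι∘uv-injective : Injective _≡_ _≡_ (ι ∘ uv m n)
      ι∘uv-injective e = proj₁ enU _ _ (trans (sym (iota-uv _)) (trans e (iota-uv _)))

corollary1 : (s : Setting) (D' : Digraph → Set) (R : Digraph) → SettingHyp s D' R →
    (a : Eo R) (eD : Fin ∣ a₂ a ∣ → Fin (size R)) (eU : Fin ∣ a₃ a ∣ → Fin (size R)) →
    EnumOf (a₂ a) eD → EnumOf (a₃ a) eU →
    let m = ∣ a₂ a ∣
        n = ∣ a₃ a ∣
        X = Xdig s m n
        ι = iota (a₁ a) eD eU
    in ((π : Aut X) → (fun π (pv m n) ≡ pv m n) × MapsOnto (fun π) (dv m n) × MapsOnto (fun π) (uv m n))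
       × (α X ι (pv m n) ≡ (a₁ a , a₂ a , a₃ a))
       × ((π : Aut X) (v : Fin (size X)) → α X (ι ∘ fun π) v ≡ α X ι (fun π v))
       × HasCard (AutSetoid X) ((m !) * (n !))
       × HasCard (ComposedSetoid X ι) ((m !) * (n !))
corollary1 s _ _ _ a eD eU enD enU =
    (λ π → fun-pv π , OnD.restriction-mapsOnto π , OnU.restriction-mapsOnto π)
  , α-iota-pv
  , (λ π → α-∘-fun π ι)
  , Inverse⇒Bijection Aut↔Fin[m!*n!]
  , Inverse⇒Bijection (Compose.inverse (Composed↔Aut ι iota∘fun-injective) Aut↔Fin[m!*n!])
  where
  open AutomorphismsOfX s ∣ a₂ a ∣ ∣ a₃ a ∣
  open Labelling (a₁ a) enD enU
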